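{- For every $n\ge1$, \[\sum_{T\in\mathcal{O}(n)}\prod_{v\in T}\left(\frac{1}{2h_v(2h_v-1)}\right)=\frac{c_{n-1}}{n(2n-1)\,2^n},\] where $c_0=1$ and $c_k=\sum_{m=0}^{k-1}\frac{c_mc_{k-1-m}}{(m+1)(2m+1)}$ for $k>0$ (so that $\mathrm{erf}^{ -1}(z)=\sum_{k\ge0}\frac{c_k}{2k+1}(\frac{\sqrt\pi}{2}z)^{2k+1}$).
   Context: $\mathcal{O}(n)$ is the set of ordered (planted plane) rooted trees with $n$ nodes. The hook-length $h_v$ of a node $v$ is the number of descendants of $v$ including $v$ itself. $\mathrm{erf}^{ -1}$ denotes the inverse of the error function $\mathrm{erf}(z)=\frac{2}{\sqrt\pi}\int_0^ze^{ -x^2}dx$. -}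

module Defs where

open import Data.Nat as ℕ using (ℕ; zero; suc; _∸_)
open import Data.Integer using (+_)
open import Data.Rational using (ℚ; _/_; _+_; _*_; 0ℚ; 1ℚ)
open import Data.List using (List; []; _∷_; concatMap; map; upTo; foldr)
open import Data.Product using (_×_; _,_)

data Tree : Set where
  node : List Tree → Tree

mutual
  -- number of nodes (= hook length of the root)
  size : Tree → ℕ
  size (node ts) = suc (sizeF ts)

  sizeF : List Tree → ℕ
  sizeF [] = 0
  sizeF (t ∷ ts) = size t ℕ.+ sizeF ts

-- 1 / (2h (2h-1)) for h = suc k :  2h(2h-1) = (2k+2)(2k+1)
hookFactor : ℕ → ℚ
hookFactor zero = 0ℚ   -- never used: hook lengths are ≥ 1
hookFactor (suc k) = + 1 / (suc (suc (2 ℕ.* k)) ℕ.* suc (2 ℕ.* k))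

mutual
  weight : Tree → ℚ
  weight (node ts) = hookFactor (size (node ts)) * weightF ts

  weightF : List Tree → ℚ
  weightF [] = 1ℚ
  weightF (t ∷ ts) = weight t * weightF ts

-- Enumeration of ordered forests / trees by number of nodes.
-- forestsF k n (for n ≤ k, k = "fuel" making recursion structural) lists every
-- ordered forest (list of trees) with exactly n nodes, each exactly once:
-- the empty forest if n = 0, otherwise a first tree  node f  with i+1 nodes
-- (f a forest with i nodes, 0 ≤ i < n) followed by a forest with n-1-i nodes.
forestsF : ℕ → ℕ → List (List Tree)
forestsF _ zero = [] ∷ []
forestsF zero (suc n) = []
forestsF (suc k) (suc n) =
  concatMap (λ i → concatMap (λ f → map (node f ∷_) (forestsF k (n ∸ i))) (forestsF k i))
            (upTo (suc n))

forests : ℕ → List (List Tree)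
forests n = forestsF n n

trees : ℕ → List Tree
trees zero = []
trees (suc n) = map node (forests n)

sumℚ : List ℚ → ℚ
sumℚ = foldr _+_ 0ℚ

cF : ℕ → ℕ → ℚ
cF _ zero = 1ℚ
cF zero (suc k) = 0ℚ
cF (suc f) (suc k) =
  sumℚ (map (λ m → cF f m * cF f (k ∸ m) * (+ 1 / (suc m ℕ.* suc (2 ℕ.* m)))) (upTo (suc k)))

c : ℕ → ℚ
c k = cF k k

-- Deleting the root of an ordered tree leaves an ordered forest, and a nonempty forest is its
-- first tree followed by a forest. So if F n is the total weight of the forests with n nodes, then
-- F 0 = 1 and F (n + 1) = Σ_{i ≤ n} φ(i + 1) F i F (n - i), where φ h = 1/(2h(2h - 1)) is the
-- weight the root of the first tree contributes. Since φ (i + 1) = 1/2 · 1/((i + 1)(2i + 1)),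
-- this is the recurrence defining c scaled by 1/2^n, so F n = c n / 2^n; attaching a root of
-- hook length n + 1 to the forests with n nodes yields the claim.
module Submission where

open import Defs
open import Data.Nat using (ℕ; suc; _*_; _^_)
open import Data.Nat.Properties using (m*n≢0; m^n≢0)
open import Data.Integer using (+_)
open import Data.Rational using (ℚ; _/_)
open import Data.Rational as ℚ using ()
open import Data.List using (map)
open import Relation.Binary.PropositionalEquality using (_≡_)

open import Data.Nat as ℕ using (zero; _+_; _∸_; _≤_; _<_; s≤s; NonZero)
import Data.Nat.Properties as ℕ
open import Data.Nat.Solver using (module +-*-Solver)
import Data.Rational.Properties as ℚ
import Data.Rational.Unnormalised as ℚᵘ
import Data.Rational.Unnormalised.Properties as ℚᵘ
open import Data.Rational.Solver renaming (module +-*-Solver to ℚ-Solver)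
open import Data.List using (List; []; _∷_; _++_; concatMap; upTo)
open import Data.List.Properties using (map-++; map-∘; map-cong-local)
open import Data.List.Relation.Unary.All as All using (All; []; _∷_)
open import Data.List.Relation.Unary.All.Properties using (applyUpTo⁺₁; map⁺; concat⁺)
open import Function using (id)
open import Relation.Binary.PropositionalEquality using (refl; sym; trans; cong; cong₂; module ≡-Reasoning)

½^_ : ℕ → ℚ
½^ n = (+ 1 / 2 ^ n) {{m^n≢0 2 n}}

1/-*-1/ : ∀ a b .{{_ : NonZero a}} .{{_ : NonZero b}} →
          (+ 1 / a) ℚ.* (+ 1 / b) ≡ (+ 1 / (a * b)) {{m*n≢0 a b}}
1/-*-1/ (suc a) (suc b) = ℚ.toℚᵘ-injective (begin
    ℚ.toℚᵘ ((+ 1 / suc a) ℚ.* (+ 1 / suc b))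
  ≈⟨ ℚ.toℚᵘ-homo-* (+ 1 / suc a) (+ 1 / suc b) ⟩
    ℚ.toℚᵘ (+ 1 / suc a) ℚᵘ.* ℚ.toℚᵘ (+ 1 / suc b)
  ≈⟨ ℚᵘ.*-cong (ℚ.toℚᵘ-fromℚᵘ (ℚᵘ.mkℚᵘ (+ 1) a)) (ℚ.toℚᵘ-fromℚᵘ (ℚᵘ.mkℚᵘ (+ 1) b)) ⟩
    ℚᵘ.mkℚᵘ (+ 1) (ℕ.pred (suc a * suc b))
  ≈⟨ ℚᵘ.≃-sym (ℚ.toℚᵘ-fromℚᵘ (ℚᵘ.mkℚᵘ (+ 1) (ℕ.pred (suc a * suc b)))) ⟩
    ℚ.toℚᵘ (+ 1 / (suc a * suc b))
  ∎)
  where open ℚᵘ.≃-Reasoning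

½^-+ : ∀ m n → ½^ m ℚ.* ½^ n ≡ ½^ (m + n)
½^-+ m n = trans (1/-*-1/ (2 ^ m) (2 ^ n) {{m^n≢0 2 m}} {{m^n≢0 2 n}})
                 (ℚ./-cong {p₁ = + 1} {{m*n≢0 (2 ^ m) (2 ^ n) {{m^n≢0 2 m}} {{m^n≢0 2 n}}}} {{m^n≢0 2 (m + n)}}
                           refl (sym (ℕ.^-distribˡ-+-* 2 m n)))

hookFactor-suc : ∀ i → hookFactor (suc i) ≡ ½^ 1 ℚ.* (+ 1 / (suc i * suc (2 * i)))
hookFactor-suc i = sym (trans (1/-*-1/ 2 (suc i * suc (2 * i)))
                              (ℚ./-cong {p₁ = + 1} {{_}} {{_}} refl (2*[1+i]*[1+2i] i)))
  where
  open +-*-Solver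
  2*[1+i]*[1+2i] : ∀ i → 2 ^ 1 * (suc i * suc (2 * i)) ≡ suc (suc (2 * i)) * suc (2 * i)
  2*[1+i]*[1+2i] = solve 1 (λ i → con 2 :* ((con 1 :+ i) :* (con 1 :+ con 2 :* i))
                               := (con 2 :+ con 2 :* i) :* (con 1 :+ con 2 :* i)) refl

sumℚ-++ : ∀ xs ys → sumℚ (xs ++ ys) ≡ sumℚ xs ℚ.+ sumℚ ys
sumℚ-++ []       ys = sym (ℚ.+-identityˡ (sumℚ ys))
sumℚ-++ (x ∷ xs) ys = trans (cong (x ℚ.+_) (sumℚ-++ xs ys)) (sym (ℚ.+-assoc x (sumℚ xs) (sumℚ ys)))

sumℚ-concatMap : ∀ {A B : Set} (g : B → ℚ) (h : A → List B) xs →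
                 sumℚ (map g (concatMap h xs)) ≡ sumℚ (map (λ x → sumℚ (map g (h x))) xs)
sumℚ-concatMap g h []       = refl
sumℚ-concatMap g h (x ∷ xs) = begin
    sumℚ (map g (h x ++ concatMap h xs))
  ≡⟨ cong sumℚ (map-++ g (h x) (concatMap h xs)) ⟩
    sumℚ (map g (h x) ++ map g (concatMap h xs))
  ≡⟨ sumℚ-++ (map g (h x)) (map g (concatMap h xs)) ⟩
    sumℚ (map g (h x)) ℚ.+ sumℚ (map g (concatMap h xs))
  ≡⟨ cong (sumℚ (map g (h x)) ℚ.+_) (sumℚ-concatMap g h xs) ⟩
    sumℚ (map g (h x)) ℚ.+ sumℚ (map (λ x → sumℚ (map g (h x))) xs)
  ∎
  where open ≡-Reasoning

sumℚ-*ˡ : ∀ {A : Set} a (g : A → ℚ) xs → sumℚ (map (λ x → a ℚ.* g x) xs) ≡ a ℚ.* sumℚ (map g xs)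
sumℚ-*ˡ a g []       = sym (ℚ.*-zeroʳ a)
sumℚ-*ˡ a g (x ∷ xs) = trans (cong (a ℚ.* g x ℚ.+_) (sumℚ-*ˡ a g xs))
                             (sym (ℚ.*-distribˡ-+ a (g x) (sumℚ (map g xs))))

sumℚ-*ʳ : ∀ {A : Set} a (g : A → ℚ) xs → sumℚ (map (λ x → g x ℚ.* a) xs) ≡ sumℚ (map g xs) ℚ.* a
sumℚ-*ʳ a g []       = sym (ℚ.*-zeroˡ a)
sumℚ-*ʳ a g (x ∷ xs) = trans (cong (g x ℚ.* a ℚ.+_) (sumℚ-*ʳ a g xs))
                             (sym (ℚ.*-distribʳ-+ a (g x) (sumℚ (map g xs))))

sumℚ-cong-All : ∀ {A : Set} {P : A → Set} {f g : A → ℚ} {xs} →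
                All P xs → (∀ {x} → P x → f x ≡ g x) → sumℚ (map f xs) ≡ sumℚ (map g xs)
sumℚ-cong-All ps f≗g = cong sumℚ (map-cong-local (All.map f≗g ps))

upTo-< : ∀ n → All (_< n) (upTo n)
upTo-< n = applyUpTo⁺₁ id n id

sumℚ-upTo-cong : ∀ n {f g : ℕ → ℚ} → (∀ i → i < n → f i ≡ g i) →
                 sumℚ (map f (upTo n)) ≡ sumℚ (map g (upTo n))
sumℚ-upTo-cong n f≗g = sumℚ-cong-All (upTo-< n) (f≗g _)

cF-fuel-irrelevant : ∀ f g {m} → m ≤ f → m ≤ g → cF f m ≡ cF g m
cF-fuel-irrelevant f       g       {zero}  _         _         = refl
cF-fuel-irrelevant (suc f) (suc g) {suc k} (s≤s k≤f) (s≤s k≤g) =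
  sumℚ-upTo-cong (suc k) λ i i<1+k →
    let i≤k = ℕ.≤-pred i<1+k ; k-i≤k = ℕ.m∸n≤m k i in
    cong₂ (λ x y → x ℚ.* y ℚ.* (+ 1 / (suc i * suc (2 * i))))
          (cF-fuel-irrelevant f g (ℕ.≤-trans i≤k k≤f) (ℕ.≤-trans i≤k k≤g))
          (cF-fuel-irrelevant f g (ℕ.≤-trans k-i≤k k≤f) (ℕ.≤-trans k-i≤k k≤g))

c-suc : ∀ n → c (suc n) ≡ sumℚ (map (λ i → c i ℚ.* c (n ∸ i) ℚ.* (+ 1 / (suc i * suc (2 * i)))) (upTo (suc n)))
c-suc n = sumℚ-upTo-cong (suc n) λ i i<1+n →
  cong₂ (λ x y → x ℚ.* y ℚ.* (+ 1 / (suc i * suc (2 * i))))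
        (cF-fuel-irrelevant n i (ℕ.≤-pred i<1+n) ℕ.≤-refl)
        (cF-fuel-irrelevant n (n ∸ i) (ℕ.m∸n≤m n i) ℕ.≤-refl)

forestsF-sizeF : ∀ k {n} → n ≤ k → All (λ f → sizeF f ≡ n) (forestsF k n)
forestsF-sizeF k       {zero}  _         = refl ∷ []
forestsF-sizeF (suc k) {suc n} (s≤s n≤k) =
  concat⁺ (map⁺ (All.map firstTree (upTo-< (suc n))))
  where
  firstTree : ∀ {i} → i < suc n →
              All (λ f → sizeF f ≡ suc n)
                  (concatMap (λ f → map (node f ∷_) (forestsF k (n ∸ i))) (forestsF k i))
  firstTree {i} i<1+n = concat⁺ (map⁺ (All.map (λ {f} sizeF-f →
      map⁺ (All.map (λ sizeF-g → cong suc (trans (cong₂ _+_ sizeF-f sizeF-g) (ℕ.m+[n∸m]≡n i≤n)))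
                    (forestsF-sizeF k (ℕ.≤-trans (ℕ.m∸n≤m n i) n≤k))))
    (forestsF-sizeF k (ℕ.≤-trans i≤n n≤k))))
    where i≤n = ℕ.≤-pred i<1+n

forestWeight : ℕ → ℕ → ℚ
forestWeight k n = sumℚ (map weightF (forestsF k n))

weight-node : ∀ {n} f → sizeF f ≡ n → weight (node f) ≡ hookFactor (suc n) ℚ.* weightF f
weight-node f refl = refl

forestWeight-first-tree : ∀ k {n i} → i ≤ n → n ≤ k →
  sumℚ (map weightF (concatMap (λ f → map (node f ∷_) (forestsF k (n ∸ i))) (forestsF k i)))
    ≡ hookFactor (suc i) ℚ.* forestWeight k i ℚ.* forestWeight k (n ∸ i)
forestWeight-first-tree k {n} {i} i≤n n≤k = begin
    sumℚ (map weightF (concatMap (λ f → map (node f ∷_) G) F))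
  ≡⟨ sumℚ-concatMap weightF (λ f → map (node f ∷_) G) F ⟩
    sumℚ (map (λ f → sumℚ (map weightF (map (node f ∷_) G))) F)
  ≡⟨ sumℚ-cong-All (forestsF-sizeF k (ℕ.≤-trans i≤n n≤k)) first ⟩
    sumℚ (map (λ f → weightF f ℚ.* (hookFactor (suc i) ℚ.* forestWeight k j)) F)
  ≡⟨ sumℚ-*ʳ (hookFactor (suc i) ℚ.* forestWeight k j) weightF F ⟩
    forestWeight k i ℚ.* (hookFactor (suc i) ℚ.* forestWeight k j)
  ≡⟨ solve 3 (λ w h s → w :* (h :* s) := h :* w :* s) refl
             (forestWeight k i) (hookFactor (suc i)) (forestWeight k j) ⟩
    hookFactor (suc i) ℚ.* forestWeight k i ℚ.* forestWeight k j
  ∎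
  where
  open ≡-Reasoning
  open ℚ-Solver
  j = n ∸ i
  F = forestsF k i
  G = forestsF k j
  first : ∀ {f} → sizeF f ≡ i →
          sumℚ (map weightF (map (node f ∷_) G)) ≡ weightF f ℚ.* (hookFactor (suc i) ℚ.* forestWeight k j)
  first {f} sizeF-f = begin
      sumℚ (map weightF (map (node f ∷_) G))
    ≡⟨ cong sumℚ (sym (map-∘ G)) ⟩
      sumℚ (map (λ g → weight (node f) ℚ.* weightF g) G)
    ≡⟨ sumℚ-*ˡ (weight (node f)) weightF G ⟩
      weight (node f) ℚ.* forestWeight k j
    ≡⟨ cong (ℚ._* forestWeight k j) (weight-node f sizeF-f) ⟩
      hookFactor (suc i) ℚ.* weightF f ℚ.* forestWeight k j
    ≡⟨ solve 3 (λ h w s → h :* w :* s := w :* (h :* s)) refl (hookFactor (suc i)) (weightF f) (forestWeight k j) ⟩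
      weightF f ℚ.* (hookFactor (suc i) ℚ.* forestWeight k j)
    ∎

forestWeight-suc : ∀ k {n} → n ≤ k →
  forestWeight (suc k) (suc n)
    ≡ sumℚ (map (λ i → hookFactor (suc i) ℚ.* forestWeight k i ℚ.* forestWeight k (n ∸ i)) (upTo (suc n)))
forestWeight-suc k {n} n≤k =
  trans (sumℚ-concatMap weightF firstTree (upTo (suc n)))
        (sumℚ-upTo-cong (suc n) λ _ i<1+n → forestWeight-first-tree k (ℕ.≤-pred i<1+n) n≤k)
  where
  firstTree : ℕ → List (List Tree)
  firstTree i = concatMap (λ f → map (node f ∷_) (forestsF k (n ∸ i))) (forestsF k i)

recurrence-term : ∀ {n i} → i ≤ n → ∀ a b →
  hookFactor (suc i) ℚ.* (a ℚ.* ½^ i) ℚ.* (b ℚ.* ½^ (n ∸ i))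
    ≡ ½^ suc n ℚ.* (a ℚ.* b ℚ.* (+ 1 / (suc i * suc (2 * i))))
recurrence-term {n} {i} i≤n a b = begin
    hookFactor (suc i) ℚ.* (a ℚ.* ½^ i) ℚ.* (b ℚ.* ½^ (n ∸ i))
  ≡⟨ cong (λ h → h ℚ.* (a ℚ.* ½^ i) ℚ.* (b ℚ.* ½^ (n ∸ i))) (hookFactor-suc i) ⟩
    ½^ 1 ℚ.* q ℚ.* (a ℚ.* ½^ i) ℚ.* (b ℚ.* ½^ (n ∸ i))
  ≡⟨ solve 6 (λ t q a x b y → t :* q :* (a :* x) :* (b :* y) := t :* (x :* y) :* (a :* b :* q))
             refl (½^ 1) q a (½^ i) b (½^ (n ∸ i)) ⟩
    ½^ 1 ℚ.* (½^ i ℚ.* ½^ (n ∸ i)) ℚ.* (a ℚ.* b ℚ.* q)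
  ≡⟨ cong (λ x → ½^ 1 ℚ.* x ℚ.* (a ℚ.* b ℚ.* q)) (½^-+ i (n ∸ i)) ⟩
    ½^ 1 ℚ.* ½^ (i + (n ∸ i)) ℚ.* (a ℚ.* b ℚ.* q)
  ≡⟨ cong (λ m → ½^ 1 ℚ.* ½^ m ℚ.* (a ℚ.* b ℚ.* q)) (ℕ.m+[n∸m]≡n i≤n) ⟩
    ½^ 1 ℚ.* ½^ n ℚ.* (a ℚ.* b ℚ.* q)
  ≡⟨ cong (ℚ._* (a ℚ.* b ℚ.* q)) (½^-+ 1 n) ⟩
    ½^ suc n ℚ.* (a ℚ.* b ℚ.* q)
  ∎
  where
  open ≡-Reasoning
  open ℚ-Solver
  q = + 1 / (suc i * suc (2 * i))

forestWeight≡c*½^ : ∀ k {n} → n ≤ k → forestWeight k n ≡ c n ℚ.* ½^ n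
forestWeight≡c*½^ k       {zero}  _         = refl
forestWeight≡c*½^ (suc k) {suc n} (s≤s n≤k) = begin
    forestWeight (suc k) (suc n)
  ≡⟨ forestWeight-suc k n≤k ⟩
    sumℚ (map (λ i → hookFactor (suc i) ℚ.* forestWeight k i ℚ.* forestWeight k (n ∸ i)) (upTo (suc n)))
  ≡⟨ sumℚ-upTo-cong (suc n) term ⟩
    sumℚ (map (λ i → ½^ suc n ℚ.* (c i ℚ.* c (n ∸ i) ℚ.* (+ 1 / (suc i * suc (2 * i))))) (upTo (suc n)))
  ≡⟨ sumℚ-*ˡ (½^ suc n) _ (upTo (suc n)) ⟩
    ½^ suc n ℚ.* sumℚ (map (λ i → c i ℚ.* c (n ∸ i) ℚ.* (+ 1 / (suc i * suc (2 * i)))) (upTo (suc n)))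
  ≡⟨ cong (½^ suc n ℚ.*_) (sym (c-suc n)) ⟩
    ½^ suc n ℚ.* c (suc n)
  ≡⟨ ℚ.*-comm (½^ suc n) (c (suc n)) ⟩
    c (suc n) ℚ.* ½^ suc n
  ∎
  where
  open ≡-Reasoning
  term : ∀ i → i < suc n →
         hookFactor (suc i) ℚ.* forestWeight k i ℚ.* forestWeight k (n ∸ i)
           ≡ ½^ suc n ℚ.* (c i ℚ.* c (n ∸ i) ℚ.* (+ 1 / (suc i * suc (2 * i))))
  term i i<1+n = trans
    (cong₂ (λ x y → hookFactor (suc i) ℚ.* x ℚ.* y)
           (forestWeight≡c*½^ k (ℕ.≤-trans i≤n n≤k))
           (forestWeight≡c*½^ k (ℕ.≤-trans (ℕ.m∸n≤m n i) n≤k)))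
    (recurrence-term i≤n (c i) (c (n ∸ i)))
    where i≤n = ℕ.≤-pred i<1+n

treeWeight≡forestWeight : ∀ n → sumℚ (map weight (trees (suc n))) ≡ forestWeight n n ℚ.* hookFactor (suc n)
treeWeight≡forestWeight n = begin
    sumℚ (map weight (map node (forests n)))
  ≡⟨ cong sumℚ (sym (map-∘ (forests n))) ⟩
    sumℚ (map (λ f → weight (node f)) (forests n))
  ≡⟨ sumℚ-cong-All (forestsF-sizeF n ℕ.≤-refl) (λ {f} sizeF-f →
       trans (weight-node f sizeF-f) (ℚ.*-comm (hookFactor (suc n)) (weightF f))) ⟩
    sumℚ (map (λ f → weightF f ℚ.* hookFactor (suc n)) (forests n))
  ≡⟨ sumℚ-*ʳ (hookFactor (suc n)) weightF (forests n) ⟩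
    forestWeight n n ℚ.* hookFactor (suc n)
  ∎
  where open ≡-Reasoning

corollary3p2 : (n : ℕ) →
    sumℚ (map weight (trees (suc n)))
      ≡ c n ℚ.* _/_ (+ 1) (suc n * suc (2 * n) * 2 ^ suc n) {{m*n≢0 (suc n * suc (2 * n)) (2 ^ suc n) {{_}} {{m^n≢0 2 (suc n)}}}}
corollary3p2 n = begin
    sumℚ (map weight (trees (suc n)))
  ≡⟨ treeWeight≡forestWeight n ⟩
    forestWeight n n ℚ.* hookFactor (suc n)
  ≡⟨ cong₂ ℚ._*_ (forestWeight≡c*½^ n ℕ.≤-refl) (hookFactor-suc n) ⟩
    c n ℚ.* ½^ n ℚ.* (½^ 1 ℚ.* q)
  ≡⟨ solve 4 (λ a x t q → a :* x :* (t :* q) := a :* (q :* (t :* x))) refl (c n) (½^ n) (½^ 1) q ⟩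
    c n ℚ.* (q ℚ.* (½^ 1 ℚ.* ½^ n))
  ≡⟨ cong (λ x → c n ℚ.* (q ℚ.* x)) (½^-+ 1 n) ⟩
    c n ℚ.* (q ℚ.* ½^ suc n)
  ≡⟨ cong (c n ℚ.*_) (1/-*-1/ (suc n * suc (2 * n)) (2 ^ suc n) {{_}} {{m^n≢0 2 (suc n)}}) ⟩
    c n ℚ.* _/_ (+ 1) (suc n * suc (2 * n) * 2 ^ suc n) {{m*n≢0 (suc n * suc (2 * n)) (2 ^ suc n) {{_}} {{m^n≢0 2 (suc n)}}}}
  ∎
  where
  open ≡-Reasoning
  open ℚ-Solver
  q = + 1 / (suc n * suc (2 * n))
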